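{- Let $q=2^r$ and $a\in\mathbb{F}_q^*$, and let $c(a)=(tr(a\,Tr\, g_1),\dots,tr(a\,Tr\, g_N))\in\mathbb{F}_2^N$. Then its Hamming weight is \[ w(c(a))=\frac{1}{2}q\{(q^2-1)-\lambda(a)K(\lambda;a)\}. \]
   Context: $q=2^r$ with $r\ge 1$; $\mathbb{F}_q$ is the field with $q$ elements; $tr(x)=x+x^2+\cdots+x^{2^{r-1}}$ is the absolute trace $\mathbb{F}_q\to\mathbb{F}_2$, $\lambda(x)=(-1)^{tr(x)}$, and $K(\lambda;a)=\sum_{\alpha\in\mathbb{F}_q^*}\lambda(\alpha+a\alpha^{ -1})$. $O(3,q)$ is the group of all $w\in GL(3,q)$ preserving the quadratic form $\theta(x_1,x_2,x_3)=x_1x_2+x_3^2$ on column vectors $\mathbb{F}_q^{3\times 1}$ (concretely, the matrices $\begin{bmatrix} a'&b&0\\ c&d&0\\ g&h&1\end{bmatrix}\in GL(3,q)$ with $a'c+g^2=0$, $bd+h^2=0$, $a'd+bc=1$); $N=|O(3,q)|=q(q^2-1)$ and $g_1,\dots,g_N$ is a fixed ordering of its elements; $Tr$ is the matrix trace. (The vectors $c(a)$, $a\in\mathbb{F}_q$, form the dual of the binary code $C(O(3,q))=\{u\in\mathbb{F}_2^N:\sum_i u_i\,Tr\,g_i=0\}$.) -}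

module Defs where

open import Level using (0ℓ)
open import Data.Nat as ℕ using (ℕ; zero; suc)
open import Data.Integer as ℤ using (ℤ; +_)
open import Data.List using (List; []; _∷_; length; filter; map; concatMap; sum)
open import Data.List.Relation.Unary.Unique.Propositional using (Unique)
open import Data.List.Membership.Propositional using (_∈_)
open import Data.Product using (_×_; _,_)
open import Relation.Binary.PropositionalEquality using (_≡_; _≢_)
open import Relation.Binary.Definitions using (DecidableEquality)
open import Relation.Nullary using (¬?; yes; no)
open import Relation.Nullary.Decidable using (_×-dec_)
open import Algebra.Structures using (IsCommutativeRing)

record GF (r : ℕ) : Set₁ where
  infixl 6 _+_
  infixl 7 _*_
  field
    F         : Set
    _+_ _*_   : F → F → F
    -_        : F → F
    0# 1#     : F
    isCommutativeRing : IsCommutativeRing _≡_ _+_ _*_ -_ 0# 1#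
    0≢1       : 0# ≢ 1#
    _⁻¹       : F → F
    inverse   : ∀ x → x ≢ 0# → x * (x ⁻¹) ≡ 1#
    _≟_       : DecidableEquality F
    elems     : List F
    elems-unique   : Unique elems
    elems-complete : ∀ x → x ∈ elems
    card      : length elems ≡ 2 ℕ.^ r

module _ {r : ℕ} (𝔽 : GF r) where
  open GF 𝔽

  pow : F → ℕ → F
  pow x zero    = 1#
  pow x (suc n) = x * pow x n

  -- absolute trace tr(x) = x + x^2 + ... + x^(2^(r-1))  (value in the prime field ⊆ F_q)
  tr : F → F
  tr x = go r
    where
    go : ℕ → F
    go zero    = 0#
    go (suc i) = go i + pow x (2 ℕ.^ i)

  λ′ : F → ℤ
  λ′ x with tr x ≟ 0#
  ... | yes _ = + 1
  ... | no  _ = ℤ.- (+ 1)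

  nonzero : List F
  nonzero = filter (λ x → ¬? (x ≟ 0#)) elems

  K : F → ℤ
  K a = ℤsum (map (λ α → λ′ (α + a * (α ⁻¹))) nonzero)
    where
    ℤsum : List ℤ → ℤ
    ℤsum []       = + 0
    ℤsum (z ∷ zs) = z ℤ.+ ℤsum zs

  -- matrices [[a',b,0],[c,d,0],[g,h,1]] recorded by (a',b,c,d,g,h)
  Mat6 : Set
  Mat6 = F × F × F × F × F × F

  allMat6 : List Mat6
  allMat6 =
    concatMap (λ a′ → concatMap (λ b → concatMap (λ c → concatMap (λ d →
      concatMap (λ g → map (λ h → (a′ , b , c , d , g , h)) elems)
      elems) elems) elems) elems) elems

  O3cond : Mat6 → Set
  O3cond (a′ , b , c , d , g , h) =
    (a′ * c + g * g ≡ 0#) × (b * d + h * h ≡ 0#) × (a′ * d + b * c ≡ 1#)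

  O3? : (m : Mat6) → Relation.Nullary.Dec (O3cond m)
  O3? (a′ , b , c , d , g , h) =
    ((a′ * c + g * g) ≟ 0#) ×-dec (((b * d + h * h) ≟ 0#) ×-dec ((a′ * d + b * c) ≟ 1#))

  O3 : List Mat6
  O3 = filter O3? allMat6

  MTr : Mat6 → F
  MTr (a′ , b , c , d , g , h) = a′ + d + 1#

  weight : F → ℕ
  weight a = length (filter (λ m → ¬? (tr (a * MTr m) ≟ 0#)) O3)

{-# OPTIONS --safe #-}

-- Since 1 − λ(u) is twice the indicator of tr u ≠ 0, 2·w(c(a)) is the sum of
-- 1 − λ(a·Tr m) over m ∈ O(3,q).  Summing over the entries (a′,b,c,d,g,h) of m:
-- g and h are forced to be the square roots of a′c and bd; the pairs (b,c)
-- with a′d + bc = 1 number q − 1 + q·[a′d = 1]; and λ sums to zero along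
-- every line d ↦ a(a′ + d + 1), because tr is a nonzero additive map (it is a
-- polynomial of degree q/2).  What is left is q times the sum of
-- 1 − λ(a)λ(ax + a/x) over x ∈ F*, and the substitution x = z²/a turns
-- λ(ax + a/x) into λ((z + a/z)²) = λ(z + a/z), the summand of K(λ;a).

module Submission where

open import Defs
open import Data.Nat as ℕ using (ℕ; zero; suc; _≤_; s≤s; z≤n)
import Data.Nat.Properties as ℕP
open import Data.Integer as ℤ using (ℤ)
import Data.Integer.Properties as ℤP
open import Data.Integer.Tactic.RingSolver using (solve-∀)
open import Data.List using (List; []; _∷_; map; foldr; filter; length; concatMap; _++_)
open import Data.List.Properties using (map-∘; map-id; filter-all)
open import Data.List.Membership.Propositional using (_∈_)
open import Data.List.Membership.Propositional.Properties using (∈-map⁺; ∈-filter⁻)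
open import Data.List.Membership.Propositional.Properties.WithK using (unique∧set⇒bag)
open import Data.List.Relation.Binary.BagAndSetEquality using (∼bag⇒↭)
open import Data.List.Relation.Binary.Permutation.Propositional using (_↭_; ↭⇒↭ₛ)
import Data.List.Relation.Binary.Permutation.Propositional.Properties as ↭
import Data.List.Relation.Binary.Permutation.Setoid.Properties as ↭ₛ
open import Data.List.Relation.Unary.All using (All; []; _∷_)
import Data.List.Relation.Unary.All as All
open import Data.List.Relation.Unary.Any using (here; there; satisfied)
open import Data.List.Relation.Unary.All.Properties using (¬All⇒Any¬)
open import Data.List.Relation.Unary.AllPairs using (_∷_)
open import Data.List.Relation.Unary.Unique.Propositional using (Unique)
import Data.List.Relation.Unary.Unique.Propositional.Properties as Unique
open import Data.Product using (Σ; _×_; _,_; proj₂)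
open import Data.Sum using (_⊎_; inj₁; inj₂; [_,_]′)
open import Data.Empty using (⊥-elim)
open import Function using (_∘_; id; mk⇔)
open import Relation.Nullary using (¬_; Dec; yes; no; ¬?)
open import Relation.Nullary.Decidable using (_×-dec_)
open import Relation.Binary.PropositionalEquality
  using (_≡_; _≢_; refl; sym; trans; cong; cong₂; subst; setoid; module ≡-Reasoning)
open import Algebra.Structures using (IsCommutativeRing; IsCommutativeMonoid)
open import Algebra.Bundles using (CommutativeRing)
import Algebra.Properties.CommutativeSemigroup as CommSemigroup

private variable A B : Set

∑ : List A → (A → ℤ) → ℤ
∑ xs f = foldr ℤ._+_ ℤ.0ℤ (map f xs)

syntax ∑ xs (λ x → e) = ∑[ x ∈ xs ] e

𝟙 : {P : Set} → Dec P → ℤ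
𝟙 (yes _) = ℤ.1ℤ
𝟙 (no _)  = ℤ.0ℤ

-- Scoped, so that ℤ's +_ does not clash with sections (x +_) of field addition later on.
module _ where
  open import Data.Integer using (_+_; _*_; +_)

  ∑-cong : ∀ xs {f g : A → ℤ} → (∀ x → f x ≡ g x) → ∑ xs f ≡ ∑ xs g
  ∑-cong []       f≗g = refl
  ∑-cong (x ∷ xs) f≗g = cong₂ _+_ (f≗g x) (∑-cong xs f≗g)

  ∑-cong-∈ : ∀ xs {f g : A → ℤ} → (∀ {x} → x ∈ xs → f x ≡ g x) → ∑ xs f ≡ ∑ xs g
  ∑-cong-∈ []       f≗g = refl
  ∑-cong-∈ (x ∷ xs) f≗g = cong₂ _+_ (f≗g (here refl)) (∑-cong-∈ xs (f≗g ∘ there))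

  ∑-+ : ∀ xs (f g : A → ℤ) → ∑[ x ∈ xs ] (f x + g x) ≡ ∑ xs f + ∑ xs g
  ∑-+ []       f g = refl
  ∑-+ (x ∷ xs) f g = begin
    (f x + g x) + ∑[ y ∈ xs ] (f y + g y) ≡⟨ cong (_+_ (f x + g x)) (∑-+ xs f g) ⟩
    (f x + g x) + (∑ xs f + ∑ xs g)       ≡⟨ CommSemigroup.interchange ℤP.+-commutativeSemigroup (f x) (g x) (∑ xs f) (∑ xs g) ⟩
    (f x + ∑ xs f) + (g x + ∑ xs g)       ∎
    where open ≡-Reasoning

  ∑-*ˡ : ∀ xs c (f : A → ℤ) → ∑[ x ∈ xs ] (c * f x) ≡ c * ∑ xs f
  ∑-*ˡ []       c f = sym (ℤP.*-zeroʳ c)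
  ∑-*ˡ (x ∷ xs) c f =
    trans (cong (_+_ (c * f x)) (∑-*ˡ xs c f)) (sym (ℤP.*-distribˡ-+ c (f x) (∑ xs f)))

  ∑-*ʳ : ∀ xs (f : A → ℤ) c → ∑[ x ∈ xs ] (f x * c) ≡ ∑ xs f * c
  ∑-*ʳ xs f c = trans (∑-cong xs (λ x → ℤP.*-comm (f x) c)) (trans (∑-*ˡ xs c f) (ℤP.*-comm c (∑ xs f)))

  ∑-const : ∀ (xs : List A) c → ∑[ _ ∈ xs ] c ≡ + length xs * c
  ∑-const []       c = sym (ℤP.*-zeroˡ c)
  ∑-const (x ∷ xs) c = begin
    c + ∑[ _ ∈ xs ] c           ≡⟨ cong (_+_ c) (∑-const xs c) ⟩
    c + + length xs * c         ≡⟨ cong (_+ + length xs * c) (ℤP.*-identityˡ c) ⟨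
    + 1 * c + + length xs * c   ≡⟨ ℤP.*-distribʳ-+ c (+ 1) (+ length xs) ⟨
    + length (x ∷ xs) * c       ∎
    where open ≡-Reasoning

  ∑-++ : ∀ xs ys (f : A → ℤ) → ∑ (xs ++ ys) f ≡ ∑ xs f + ∑ ys f
  ∑-++ []       ys f = sym (ℤP.+-identityˡ _)
  ∑-++ (x ∷ xs) ys f = trans (cong (_+_ (f x)) (∑-++ xs ys f)) (sym (ℤP.+-assoc (f x) _ _))

  ∑-map : (g : B → A) (xs : List B) (f : A → ℤ) → ∑ (map g xs) f ≡ ∑[ x ∈ xs ] f (g x)
  ∑-map g []       f = refl
  ∑-map g (x ∷ xs) f = cong (_+_ (f (g x))) (∑-map g xs f)

  ∑-concatMap : (g : B → List A) (xs : List B) (f : A → ℤ) →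
                ∑ (concatMap g xs) f ≡ ∑[ x ∈ xs ] ∑ (g x) f
  ∑-concatMap g []       f = refl
  ∑-concatMap g (x ∷ xs) f =
    trans (∑-++ (g x) (concatMap g xs) f) (cong (_+_ (∑ (g x) f)) (∑-concatMap g xs f))

  ∑-swap : (xs : List A) (ys : List B) (f : A → B → ℤ) →
           ∑[ x ∈ xs ] ∑[ y ∈ ys ] f x y ≡ ∑[ y ∈ ys ] ∑[ x ∈ xs ] f x y
  ∑-swap []       ys f = sym (trans (∑-const ys (+ 0)) (ℤP.*-zeroʳ (+ length ys)))
  ∑-swap (x ∷ xs) ys f = trans (cong (_+_ (∑ ys (f x))) (∑-swap xs ys f))
                               (sym (∑-+ ys (f x) (λ y → ∑[ x′ ∈ xs ] f x′ y)))

  module _ {P : A → Set} (P? : ∀ x → Dec (P x)) where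

    ∑-filter : ∀ xs (f : A → ℤ) → ∑ (filter P? xs) f ≡ ∑[ x ∈ xs ] (𝟙 (P? x) * f x)
    ∑-filter []       f = refl
    ∑-filter (x ∷ xs) f with P? x
    ... | yes _ = cong₂ _+_ (sym (ℤP.*-identityˡ (f x))) (∑-filter xs f)
    ... | no  _ = trans (∑-filter xs f) (sym (ℤP.+-identityˡ _))

    length-filter : ∀ xs → + length (filter P? xs) ≡ ∑[ x ∈ xs ] 𝟙 (P? x)
    length-filter []       = refl
    length-filter (x ∷ xs) with P? x
    ... | yes _ = cong (_+_ (+ 1)) (length-filter xs)
    ... | no  _ = trans (length-filter xs) (sym (ℤP.+-identityˡ _))

    ∑-𝟙-none : ∀ xs (f : A → ℤ) → All (¬_ ∘ P) xs → ∑[ x ∈ xs ] (𝟙 (P? x) * f x) ≡ + 0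
    ∑-𝟙-none []       f []         = refl
    ∑-𝟙-none (x ∷ xs) f (¬px ∷ ¬P) with P? x
    ... | yes px = ⊥-elim (¬px px)
    ... | no  _  = trans (ℤP.+-identityˡ _) (∑-𝟙-none xs f ¬P)

    ∑-𝟙-unique : ∀ xs x₀ → Unique xs → x₀ ∈ xs → P x₀ → (∀ x → P x → x ≡ x₀) →
                 (f : A → ℤ) → ∑[ x ∈ xs ] (𝟙 (P? x) * f x) ≡ f x₀
    ∑-𝟙-unique (x ∷ xs) x₀ (x∉xs ∷ unique) x₀∈ Px₀ only f with P? x
    ... | yes px = begin
      + 1 * f x + ∑[ y ∈ xs ] (𝟙 (P? y) * f y) ≡⟨ cong₂ _+_ (ℤP.*-identityˡ (f x)) (∑-𝟙-none xs f ¬P) ⟩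
      f x + + 0                                ≡⟨ ℤP.+-identityʳ (f x) ⟩
      f x                                      ≡⟨ cong f (only x px) ⟩
      f x₀                                     ∎
      where
      open ≡-Reasoning
      ¬P : All (¬_ ∘ P) xs
      ¬P = All.map (λ x≢y Py → x≢y (trans (only x px) (sym (only _ Py)))) x∉xs
    ... | no ¬px with x₀∈
    ...   | here refl = ⊥-elim (¬px Px₀)
    ...   | there x₀∈xs = trans (ℤP.+-identityˡ _) (∑-𝟙-unique xs x₀ unique x₀∈xs Px₀ only f)

i≡-i⇒i≡0 : ∀ {i} → i ≡ ℤ.- i → i ≡ ℤ.0ℤ
i≡-i⇒i≡0 {ℤ.+ zero}   _  = refl
i≡-i⇒i≡0 {ℤ.+[1+ _ ]} ()
i≡-i⇒i≡0 {ℤ.-[1+ _ ]} ()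

𝟙-× : {P Q : Set} (p : Dec P) (q : Dec Q) → 𝟙 (p ×-dec q) ≡ 𝟙 p ℤ.* 𝟙 q
𝟙-× (yes _) (yes _) = refl
𝟙-× (yes _) (no  _) = refl
𝟙-× (no  _) (yes _) = refl
𝟙-× (no  _) (no  _) = refl

module _ {xs : List A} (unique : Unique xs) (complete : ∀ x → x ∈ xs)
         (σ τ : A → A) (στ : ∀ x → σ (τ x) ≡ x) (τσ : ∀ x → τ (σ x) ≡ x) where

  map-bijection-↭ : map σ xs ↭ xs
  map-bijection-↭ = ∼bag⇒↭ (unique∧set⇒bag
    (Unique.map⁺ (λ {x} {y} σx≡σy → trans (sym (τσ x)) (trans (cong τ σx≡σy) (τσ y))) unique)
    unique
    (λ {x} → mk⇔ (λ _ → complete x)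
                 (λ _ → subst (_∈ map σ xs) (στ x) (∈-map⁺ σ (complete (τ x))))))

  foldr-map-bijection : {_∙_ : B → B → B} {ε : B} → IsCommutativeMonoid _≡_ _∙_ ε →
                        (f : A → B) → foldr _∙_ ε (map (f ∘ σ) xs) ≡ foldr _∙_ ε (map f xs)
  foldr-map-bijection {B = B} isCM f = trans (cong (foldr _ _) (map-∘ xs))
    (↭ₛ.foldr-commMonoid (setoid B) isCM (↭⇒↭ₛ (↭.map⁺ f map-bijection-↭)))

  ∑-bijection : (f : A → ℤ) → ∑[ x ∈ xs ] f (σ x) ≡ ∑ xs f
  ∑-bijection = foldr-map-bijection ℤP.+-0-isCommutativeMonoid

-- tr and K compute through local helpers of Defs; solving a meta by
-- unification exposes them.  Abstracting suc r turns the problem for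
-- traceUpTo into a pattern (the index would otherwise occur twice).
mutual
  traceUpTo : ∀ {r} (𝔽 : GF r) → GF.F 𝔽 → ℕ → GF.F 𝔽
  traceUpTo = _

  tr-unfold : ∀ {r} (𝔽 : GF (suc r)) x →
              tr 𝔽 x ≡ GF._+_ 𝔽 (traceUpTo 𝔽 x r) (pow 𝔽 x (2 ℕ.^ r))
  tr-unfold {r} 𝔽 x with suc r | 𝔽
  ... | _ | _ = refl

mutual
  K-sum : ∀ {r} (𝔽 : GF r) → GF.F 𝔽 → List ℤ → ℤ
  K-sum = _

  K-unfold : ∀ {r} (𝔽 : GF r) a → let open GF 𝔽 in
             K 𝔽 a ≡ K-sum 𝔽 a (map (λ α → λ′ 𝔽 (α + a * α ⁻¹)) (nonzero 𝔽))
  K-unfold 𝔽 a with map (λ α → λ′ 𝔽 (GF._+_ 𝔽 α (GF._*_ 𝔽 a (GF._⁻¹ 𝔽 α)))) (nonzero 𝔽)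
  ... | _ = refl

K-sum-map : ∀ {r} (𝔽 : GF r) a (f : A → ℤ) xs → K-sum 𝔽 a (map f xs) ≡ ∑ xs f
K-sum-map 𝔽 a f []       = refl
K-sum-map 𝔽 a f (x ∷ xs) = cong (ℤ._+_ (f x)) (K-sum-map 𝔽 a f xs)

module Field {r : ℕ} (𝔽 : GF r) where

  open GF 𝔽
  open IsCommutativeRing isCommutativeRing
    using (+-assoc; +-comm; +-identityˡ; +-identityʳ; -‿inverseˡ; -‿inverseʳ; *-assoc; *-comm;
           *-identityˡ; *-identityʳ; zeroˡ; zeroʳ; +-isCommutativeMonoid; *-isCommutativeMonoid)
    public

  commutativeRing : CommutativeRing _ _
  commutativeRing = record { isCommutativeRing = isCommutativeRing }

  open import Algebra.Solver.Ring.NaturalCoefficients.Default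
    (CommutativeRing.commutativeSemiring commutativeRing) public

  q : ℕ
  q = 2 ℕ.^ r

  nonzero? : ∀ x → Dec (x ≢ 0#)
  nonzero? x = ¬? (x ≟ 0#)

  ∈-nonzero⇒≢0 : ∀ {x} → x ∈ nonzero 𝔽 → x ≢ 0#
  ∈-nonzero⇒≢0 = proj₂ ∘ ∈-filter⁻ nonzero? {xs = elems}

  ⁻¹-cancelˡ : ∀ {x} y → x ≢ 0# → x ⁻¹ * (x * y) ≡ y
  ⁻¹-cancelˡ {x} y x≢0 = begin
    x ⁻¹ * (x * y) ≡⟨ *-assoc _ _ _ ⟨
    x ⁻¹ * x * y   ≡⟨ cong (_* y) (trans (*-comm _ _) (inverse x x≢0)) ⟩
    1# * y         ≡⟨ *-identityˡ y ⟩
    y              ∎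
    where open ≡-Reasoning

  ⁻¹-cancelʳ : ∀ {x} y → x ≢ 0# → x * (x ⁻¹ * y) ≡ y
  ⁻¹-cancelʳ {x} y x≢0 =
    trans (sym (*-assoc _ _ _)) (trans (cong (_* y) (inverse x x≢0)) (*-identityˡ y))

  ⁻¹-unique : ∀ {x y} → x ≢ 0# → x * y ≡ 1# → x ⁻¹ ≡ y
  ⁻¹-unique {x} {y} x≢0 xy≡1 =
    trans (sym (*-identityʳ _)) (trans (cong (x ⁻¹ *_) (sym xy≡1)) (⁻¹-cancelˡ y x≢0))

  zero-product : ∀ x y → x * y ≡ 0# → x ≡ 0# ⊎ y ≡ 0#
  zero-product x y xy≡0 with x ≟ 0#
  ... | yes x≡0 = inj₁ x≡0
  ... | no  x≢0 = inj₂ (trans (sym (⁻¹-cancelˡ y x≢0)) (trans (cong (x ⁻¹ *_) xy≡0) (zeroʳ _)))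

  *-nonzero : ∀ {x y} → x ≢ 0# → y ≢ 0# → x * y ≢ 0#
  *-nonzero {x} {y} x≢0 y≢0 xy≡0 with zero-product x y xy≡0
  ... | inj₁ x≡0 = x≢0 x≡0
  ... | inj₂ y≡0 = y≢0 y≡0

  ⁻¹-nonzero : ∀ {x} → x ≢ 0# → x ⁻¹ ≢ 0#
  ⁻¹-nonzero {x} x≢0 x⁻¹≡0 = 0≢1 (trans (sym (zeroʳ x)) (trans (cong (x *_) (sym x⁻¹≡0)) (inverse x x≢0)))

  open import Algebra.Properties.Group (CommutativeRing.+-group commutativeRing)
    using () renaming (∙-cancelʳ to +-cancelʳ) public

  *-cancelʳ : ∀ {z} x y → z ≢ 0# → x * z ≡ y * z → x ≡ y
  *-cancelʳ {z} x y z≢0 xz≡yz = begin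
    x              ≡⟨ ⁻¹-cancelˡ x z≢0 ⟨
    z ⁻¹ * (z * x) ≡⟨ cong (z ⁻¹ *_) (trans (*-comm z x) (trans xz≡yz (*-comm y z))) ⟩
    z ⁻¹ * (z * y) ≡⟨ ⁻¹-cancelˡ y z≢0 ⟩
    y              ∎
    where open ≡-Reasoning

  pow-+ : ∀ x m n → pow 𝔽 x (m ℕ.+ n) ≡ pow 𝔽 x m * pow 𝔽 x n
  pow-+ x zero    n = sym (*-identityˡ _)
  pow-+ x (suc m) n = trans (cong (x *_) (pow-+ x m n)) (sym (*-assoc _ _ _))

  pow-* : ∀ x y n → pow 𝔽 (x * y) n ≡ pow 𝔽 x n * pow 𝔽 y n
  pow-* x y zero    = sym (*-identityˡ _)
  pow-* x y (suc n) = trans (cong ((x * y) *_) (pow-* x y n))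
    (solve 4 (λ x y xⁿ yⁿ → (x :* y) :* (xⁿ :* yⁿ) := (x :* xⁿ) :* (y :* yⁿ)) refl x y _ _)

  pow-zero : ∀ x k → pow 𝔽 x (suc k) ≡ 0# → x ≡ 0#
  pow-zero x k xᵏ⁺¹≡0 with zero-product x (pow 𝔽 x k) xᵏ⁺¹≡0
  pow-zero x k       _ | inj₁ x≡0  = x≡0
  pow-zero x zero    _ | inj₂ 1≡0  = ⊥-elim (0≢1 (sym 1≡0))
  pow-zero x (suc k) _ | inj₂ xᵏ≡0 = pow-zero x k xᵏ≡0

  ∑-𝟙-solution : {P : F → Set} (P? : ∀ x → Dec (P x)) {x₀ : F} → P x₀ → (∀ x → P x → x ≡ x₀) →
                 (f : F → ℤ) → ∑[ x ∈ elems ] (𝟙 (P? x) ℤ.* f x) ≡ f x₀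
  ∑-𝟙-solution P? {x₀} Px₀ only =
    ∑-𝟙-unique P? elems x₀ elems-unique (elems-complete x₀) Px₀ only

  ∑-split-zero : (f : F → ℤ) → ∑ elems f ≡ f 0# ℤ.+ ∑ (nonzero 𝔽) f
  ∑-split-zero f = begin
    ∑ elems f
      ≡⟨ ∑-cong elems split ⟩
    ∑[ x ∈ elems ] (𝟙 (x ≟ 0#) ℤ.* f x ℤ.+ 𝟙 (nonzero? x) ℤ.* f x)
      ≡⟨ ∑-+ elems _ _ ⟩
    ∑[ x ∈ elems ] (𝟙 (x ≟ 0#) ℤ.* f x) ℤ.+ ∑[ x ∈ elems ] (𝟙 (nonzero? x) ℤ.* f x)
      ≡⟨ cong₂ ℤ._+_ (∑-𝟙-solution (_≟ 0#) refl (λ _ x≡0 → x≡0) f) (sym (∑-filter nonzero? elems f)) ⟩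
    f 0# ℤ.+ ∑ (nonzero 𝔽) f
      ∎
    where
    open ≡-Reasoning
    split : ∀ x → f x ≡ 𝟙 (x ≟ 0#) ℤ.* f x ℤ.+ 𝟙 (nonzero? x) ℤ.* f x
    split x with x ≟ 0#
    ... | yes _ = sym (trans (ℤP.+-identityʳ _) (ℤP.*-identityˡ (f x)))
    ... | no  _ = sym (trans (ℤP.+-identityˡ _) (ℤP.*-identityˡ (f x)))

  ∑-const-elems : ∀ c → ∑[ _ ∈ elems ] c ≡ ℤ.+ q ℤ.* c
  ∑-const-elems c = trans (∑-const elems c) (cong (λ n → ℤ.+ n ℤ.* c) card)

  length-filter-nonzero : ∀ xs → Unique xs → 0# ∈ xs → length xs ≡ suc (length (filter nonzero? xs))
  length-filter-nonzero (x ∷ xs) (x∉xs ∷ _) _ with x ≟ 0#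
  ... | yes refl = cong suc (cong length (sym (filter-all nonzero? (All.map (λ 0≢y y≡0 → 0≢y (sym y≡0)) x∉xs))))
  length-filter-nonzero (x ∷ xs) (_ ∷ unique) (here 0≡x)   | no x≢0 = ⊥-elim (x≢0 (sym 0≡x))
  length-filter-nonzero (x ∷ xs) (_ ∷ unique) (there 0∈xs) | no _   =
    cong suc (length-filter-nonzero xs unique 0∈xs)

  q≡1+|nonzero| : q ≡ suc (length (nonzero 𝔽))
  q≡1+|nonzero| = trans (sym card) (length-filter-nonzero elems elems-unique (elems-complete 0#))

  x+c+d≡x : ∀ x {c d} → c + d ≡ 0# → x + c + d ≡ x
  x+c+d≡x x {c} {d} c+d≡0 = trans (+-assoc x c d) (trans (cong (x +_) c+d≡0) (+-identityʳ x))

  ∑-affine : ∀ {a} → a ≢ 0# → ∀ b (f : F → ℤ) → ∑[ x ∈ elems ] f (a * x + b) ≡ ∑ elems f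
  ∑-affine {a} a≢0 b = ∑-bijection elems-unique elems-complete (λ x → a * x + b) (λ y → a ⁻¹ * (y + - b))
    (λ y → trans (cong (_+ b) (⁻¹-cancelʳ _ a≢0)) (x+c+d≡x y (-‿inverseˡ b)))
    (λ x → trans (cong (a ⁻¹ *_) (x+c+d≡x (a * x) (-‿inverseʳ b))) (⁻¹-cancelˡ x a≢0))

  -- Replacing 0 by 1 lets a product over all of F stand in for the product over F*.
  unzero : F → F
  unzero x with x ≟ 0#
  ... | yes _ = 1#
  ... | no  _ = x

  ∏ : List F → F
  ∏ = foldr _*_ 1#

  ∏-unzero-nonzero : ∀ xs → ∏ (map unzero xs) ≢ 0#
  ∏-unzero-nonzero []       1≡0 = 0≢1 (sym 1≡0)
  ∏-unzero-nonzero (x ∷ xs) = *-nonzero (unzero-nonzero x) (∏-unzero-nonzero xs)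
    where
    unzero-nonzero : ∀ x → unzero x ≢ 0#
    unzero-nonzero x with x ≟ 0#
    ... | yes _   = λ 1≡0 → 0≢1 (sym 1≡0)
    ... | no  x≢0 = x≢0

  ∏-unzero-scale : ∀ {a} → a ≢ 0# → ∀ xs →
    ∏ (map (unzero ∘ (a *_)) xs) ≡ pow 𝔽 a (length (filter nonzero? xs)) * ∏ (map unzero xs)
  ∏-unzero-scale a≢0 [] = sym (*-identityˡ 1#)
  ∏-unzero-scale {a} a≢0 (x ∷ xs) with x ≟ 0# | (a * x) ≟ 0#
  ... | yes _   | yes _    = trans (*-identityˡ _)
    (trans (∏-unzero-scale a≢0 xs) (cong (pow 𝔽 a (length (filter nonzero? xs)) *_) (sym (*-identityˡ _))))
  ... | yes x≡0 | no ax≢0  = ⊥-elim (ax≢0 (trans (cong (a *_) x≡0) (zeroʳ a)))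
  ... | no  x≢0 | yes ax≡0 = ⊥-elim (*-nonzero a≢0 x≢0 ax≡0)
  ... | no  _   | no  _    = trans (cong ((a * x) *_) (∏-unzero-scale a≢0 xs))
    (solve 4 (λ a x aⁿ p → (a :* x) :* (aⁿ :* p) := (a :* aⁿ) :* (x :* p)) refl a x _ _)

  pow-|nonzero| : ∀ {a} → a ≢ 0# → pow 𝔽 a (length (nonzero 𝔽)) ≡ 1#
  pow-|nonzero| {a} a≢0 = *-cancelʳ _ _ (∏-unzero-nonzero elems) (begin
    pow 𝔽 a (length (nonzero 𝔽)) * ∏ (map unzero elems) ≡⟨ ∏-unzero-scale a≢0 elems ⟨
    ∏ (map (unzero ∘ (a *_)) elems)                      ≡⟨ foldr-map-bijection elems-unique elems-complete
                                                              (a *_) (a ⁻¹ *_) (λ x → ⁻¹-cancelʳ x a≢0)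
                                                              (λ x → ⁻¹-cancelˡ x a≢0) *-isCommutativeMonoid unzero ⟩
    ∏ (map unzero elems)                                 ≡⟨ *-identityˡ _ ⟨
    1# * ∏ (map unzero elems)                            ∎)
    where open ≡-Reasoning

  pow-q : ∀ x → pow 𝔽 x q ≡ x
  pow-q x rewrite q≡1+|nonzero| = x·xᴺ≡x (x ≟ 0#)
    where
    x·xᴺ≡x : Dec (x ≡ 0#) → x * pow 𝔽 x (length (nonzero 𝔽)) ≡ x
    x·xᴺ≡x (yes x≡0) = trans (cong (_* pow 𝔽 x (length (nonzero 𝔽))) x≡0) (trans (zeroˡ _) (sym x≡0))
    x·xᴺ≡x (no  x≢0) = trans (cong (x *_) (pow-|nonzero| x≢0)) (*-identityʳ x)

module CharTwo {r : ℕ} (𝔽 : GF (suc r)) where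

  open GF 𝔽
  open Field 𝔽
  open import Algebra.Properties.Semiring.Mult (CommutativeRing.semiring commutativeRing)
    using (×1-homo-*) renaming (_×_ to _×ᶠ_)
  open import Algebra.Properties.Group (CommutativeRing.+-group commutativeRing)
    using () renaming (∙-cancelˡ to +-cancelˡ)

  foldr-+-shift : ∀ c xs → foldr _+_ 0# (map (_+ c) xs) ≡ foldr _+_ 0# xs + length xs ×ᶠ c
  foldr-+-shift c []       = sym (+-identityʳ 0#)
  foldr-+-shift c (x ∷ xs) = trans (cong ((x + c) +_) (foldr-+-shift c xs))
    (solve 4 (λ x c s m → (x :+ c) :+ (s :+ m) := (x :+ s) :+ (c :+ m)) refl x c _ _)

  -- Translation by 1 permutes F, so it leaves the sum of all elements unchanged.
  q×1≡0 : q ×ᶠ 1# ≡ 0#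
  q×1≡0 = +-cancelˡ s _ _ (begin
    s + q ×ᶠ 1#                        ≡⟨ cong (λ n → s + n ×ᶠ 1#) card ⟨
    s + length elems ×ᶠ 1#             ≡⟨ foldr-+-shift 1# elems ⟨
    foldr _+_ 0# (map (_+ 1#) elems)   ≡⟨ foldr-map-bijection elems-unique elems-complete (_+ 1#) (_+ - 1#)
                                             (λ x → x+c+d≡x x (-‿inverseˡ 1#)) (λ x → x+c+d≡x x (-‿inverseʳ 1#))
                                             +-isCommutativeMonoid id ⟩
    foldr _+_ 0# (map id elems)        ≡⟨ cong (foldr _+_ 0#) (map-id elems) ⟩
    s                                  ≡⟨ +-identityʳ s ⟨
    s + 0#                             ∎)
    where
    open ≡-Reasoning
    s : F
    s = foldr _+_ 0# elems

  two : F
  two = 1# + 1#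

  two≡0 : two ≡ 0#
  two≡0 = pow-zero two r (trans (sym (2^k×1≡twoᵏ (suc r))) q×1≡0)
    where
    2^k×1≡twoᵏ : ∀ k → (2 ℕ.^ k) ×ᶠ 1# ≡ pow 𝔽 two k
    2^k×1≡twoᵏ zero    = +-identityʳ 1#
    2^k×1≡twoᵏ (suc k) = trans (×1-homo-* 2 (2 ℕ.^ k))
      (cong₂ _*_ (cong (1# +_) (+-identityʳ 1#)) (2^k×1≡twoᵏ k))

  drop-two : ∀ x y → x + two * y ≡ x
  drop-two x y = trans (cong (λ t → x + t * y) two≡0) (trans (cong (x +_) (zeroˡ y)) (+-identityʳ x))

  x+x≡0 : ∀ x → x + x ≡ 0#
  x+x≡0 x = trans (solve 1 (λ x → x :+ x := con 0 :+ (con 1 :+ con 1) :* x) refl x) (drop-two 0# x)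

  x+y≡0⇒x≡y : ∀ {x y} → x + y ≡ 0# → x ≡ y
  x+y≡0⇒x≡y {x} {y} x+y≡0 = +-cancelʳ y x y (trans x+y≡0 (sym (x+x≡0 y)))

  square-+ : ∀ x y → (x + y) * (x + y) ≡ x * x + y * y
  square-+ x y = trans (solve 2 (λ x y → (x :+ y) :* (x :+ y) := (x :* x :+ y :* y) :+ (con 1 :+ con 1) :* (x :* y)) refl x y)
                       (drop-two _ _)

  square-injective : ∀ {x y} → x * x ≡ y * y → x ≡ y
  square-injective {x} {y} x²≡y² with zero-product (x + y) (x + y) (trans (square-+ x y) (trans (cong (_+ y * y) x²≡y²) (x+x≡0 _)))
  ... | inj₁ x+y≡0 = x+y≡0⇒x≡y x+y≡0
  ... | inj₂ x+y≡0 = x+y≡0⇒x≡y x+y≡0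

  pow-2^-suc : ∀ x i → pow 𝔽 x (2 ℕ.^ suc i) ≡ pow 𝔽 x (2 ℕ.^ i) * pow 𝔽 x (2 ℕ.^ i)
  pow-2^-suc x i = trans (pow-+ x (2 ℕ.^ i) (2 ℕ.^ i ℕ.+ 0))
    (cong (pow 𝔽 x (2 ℕ.^ i) *_) (trans (pow-+ x (2 ℕ.^ i) 0) (*-identityʳ _)))

  frobenius : ∀ i x y → pow 𝔽 (x + y) (2 ℕ.^ i) ≡ pow 𝔽 x (2 ℕ.^ i) + pow 𝔽 y (2 ℕ.^ i)
  frobenius zero    x y = trans (*-identityʳ _) (sym (cong₂ _+_ (*-identityʳ x) (*-identityʳ y)))
  frobenius (suc i) x y = begin
    pow 𝔽 (x + y) (2 ℕ.^ suc i)                    ≡⟨ pow-2^-suc (x + y) i ⟩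
    φ (x + y) * φ (x + y)                          ≡⟨ cong₂ _*_ (frobenius i x y) (frobenius i x y) ⟩
    (φ x + φ y) * (φ x + φ y)                      ≡⟨ square-+ (φ x) (φ y) ⟩
    φ x * φ x + φ y * φ y                          ≡⟨ cong₂ _+_ (pow-2^-suc x i) (pow-2^-suc y i) ⟨
    pow 𝔽 x (2 ℕ.^ suc i) + pow 𝔽 y (2 ℕ.^ suc i) ∎
    where
    open ≡-Reasoning
    φ : F → F
    φ z = pow 𝔽 z (2 ℕ.^ i)

  traceUpTo-+ : ∀ k x y → traceUpTo 𝔽 (x + y) k ≡ traceUpTo 𝔽 x k + traceUpTo 𝔽 y k
  traceUpTo-+ zero    x y = sym (+-identityʳ 0#)
  traceUpTo-+ (suc k) x y = trans (cong₂ _+_ (traceUpTo-+ k x y) (frobenius k x y))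
    (solve 4 (λ a b c d → (a :+ b) :+ (c :+ d) := (a :+ c) :+ (b :+ d)) refl _ _ _ _)

  pow-square-2^ : ∀ i x → pow 𝔽 (x * x) (2 ℕ.^ i) ≡ pow 𝔽 x (2 ℕ.^ suc i)
  pow-square-2^ i x = trans (pow-* x x (2 ℕ.^ i)) (sym (pow-2^-suc x i))

  traceUpTo-square : ∀ k x → traceUpTo 𝔽 (x * x) k + x ≡ traceUpTo 𝔽 x k + pow 𝔽 x (2 ℕ.^ k)
  traceUpTo-square zero    x = trans (+-identityˡ x) (sym (trans (+-identityˡ _) (*-identityʳ x)))
  traceUpTo-square (suc k) x = begin
    traceUpTo 𝔽 (x * x) k + pow 𝔽 (x * x) (2 ℕ.^ k) + x
      ≡⟨ solve 3 (λ a b c → (a :+ b) :+ c := (a :+ c) :+ b) refl _ _ x ⟩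
    traceUpTo 𝔽 (x * x) k + x + pow 𝔽 (x * x) (2 ℕ.^ k)
      ≡⟨ cong₂ _+_ (traceUpTo-square k x) (pow-square-2^ k x) ⟩
    traceUpTo 𝔽 x k + pow 𝔽 x (2 ℕ.^ k) + pow 𝔽 x (2 ℕ.^ suc k)
      ∎
    where open ≡-Reasoning

  traceUpTo-² : ∀ k x → traceUpTo 𝔽 x k * traceUpTo 𝔽 x k ≡ traceUpTo 𝔽 (x * x) k
  traceUpTo-² zero    x = zeroˡ 0#
  traceUpTo-² (suc k) x = begin
    (traceUpTo 𝔽 x k + φ) * (traceUpTo 𝔽 x k + φ)           ≡⟨ square-+ _ _ ⟩
    traceUpTo 𝔽 x k * traceUpTo 𝔽 x k + φ * φ               ≡⟨ cong₂ _+_ (traceUpTo-² k x) (sym (pow-2^-suc x k)) ⟩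
    traceUpTo 𝔽 (x * x) k + pow 𝔽 x (2 ℕ.^ suc k)           ≡⟨ cong (traceUpTo 𝔽 (x * x) k +_) (pow-square-2^ k x) ⟨
    traceUpTo 𝔽 (x * x) (suc k)                             ∎
    where
    open ≡-Reasoning
    φ : F
    φ = pow 𝔽 x (2 ℕ.^ k)

  tr-+ : ∀ x y → tr 𝔽 (x + y) ≡ tr 𝔽 x + tr 𝔽 y
  tr-+ = traceUpTo-+ (suc r)

  -- Squaring shifts the terms x^(2^i) of the trace by one place; the term that falls off is x^q = x.
  tr-square : ∀ x → tr 𝔽 (x * x) ≡ tr 𝔽 x
  tr-square x = +-cancelʳ x _ _ (begin
    tr 𝔽 (x * x) + x                           ≡⟨ traceUpTo-square (suc r) x ⟩
    traceUpTo 𝔽 x (suc r) + pow 𝔽 x q          ≡⟨ cong₂ _+_ (sym (tr-unfold 𝔽 x)) (pow-q x) ⟩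
    tr 𝔽 x + x                                 ∎)
    where open ≡-Reasoning

  tr-0-or-1 : ∀ x → tr 𝔽 x ≡ 0# ⊎ tr 𝔽 x ≡ 1#
  tr-0-or-1 x with zero-product t (t + 1#) t[t+1]≡0
    where
    t : F
    t = tr 𝔽 x
    t[t+1]≡0 : t * (t + 1#) ≡ 0#
    t[t+1]≡0 = begin
      t * (t + 1#) ≡⟨ solve 1 (λ t → t :* (t :+ con 1) := t :* t :+ t) refl t ⟩
      t * t + t    ≡⟨ cong (_+ t) (trans (traceUpTo-² (suc r) x) (tr-square x)) ⟩
      t + t        ≡⟨ x+x≡0 t ⟩
      0#           ∎
      where open ≡-Reasoning
  ... | inj₁ t≡0   = inj₁ t≡0
  ... | inj₂ t+1≡0 = inj₂ (x+y≡0⇒x≡y t+1≡0)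

  λ′-tr≡0 : ∀ {u} → tr 𝔽 u ≡ 0# → λ′ 𝔽 u ≡ ℤ.1ℤ
  λ′-tr≡0 {u} tr≡0 with tr 𝔽 u ≟ 0#
  ... | yes _    = refl
  ... | no tr≢0 = ⊥-elim (tr≢0 tr≡0)

  λ′-tr≡1 : ∀ {u} → tr 𝔽 u ≡ 1# → λ′ 𝔽 u ≡ ℤ.-1ℤ
  λ′-tr≡1 {u} tr≡1 with tr 𝔽 u ≟ 0#
  ... | yes tr≡0 = ⊥-elim (0≢1 (trans (sym tr≡0) tr≡1))
  ... | no _     = refl

  λ′-square : ∀ u → λ′ 𝔽 (u * u) ≡ λ′ 𝔽 u
  λ′-square u with tr-0-or-1 u
  ... | inj₁ tr≡0 = trans (λ′-tr≡0 (trans (tr-square u) tr≡0)) (sym (λ′-tr≡0 tr≡0))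
  ... | inj₂ tr≡1 = trans (λ′-tr≡1 (trans (tr-square u) tr≡1)) (sym (λ′-tr≡1 tr≡1))

  tr-+-values : ∀ {u v s t} → tr 𝔽 u ≡ s → tr 𝔽 v ≡ t → tr 𝔽 (u + v) ≡ s + t
  tr-+-values {u} {v} tr-u tr-v = trans (tr-+ u v) (cong₂ _+_ tr-u tr-v)

  λ′-+ : ∀ u v → λ′ 𝔽 (u + v) ≡ λ′ 𝔽 u ℤ.* λ′ 𝔽 v
  λ′-+ u v with tr-0-or-1 u | tr-0-or-1 v
  ... | inj₁ u₀ | inj₁ v₀ = trans (λ′-tr≡0 (trans (tr-+-values u₀ v₀) (+-identityˡ 0#)))
                                  (sym (cong₂ ℤ._*_ (λ′-tr≡0 u₀) (λ′-tr≡0 v₀)))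
  ... | inj₁ u₀ | inj₂ v₁ = trans (λ′-tr≡1 (trans (tr-+-values u₀ v₁) (+-identityˡ 1#)))
                                  (sym (cong₂ ℤ._*_ (λ′-tr≡0 u₀) (λ′-tr≡1 v₁)))
  ... | inj₂ u₁ | inj₁ v₀ = trans (λ′-tr≡1 (trans (tr-+-values u₁ v₀) (+-identityʳ 1#)))
                                  (sym (cong₂ ℤ._*_ (λ′-tr≡1 u₁) (λ′-tr≡0 v₀)))
  ... | inj₂ u₁ | inj₂ v₁ = trans (λ′-tr≡0 (trans (tr-+-values u₁ v₁) (x+x≡0 1#)))
                                  (sym (cong₂ ℤ._*_ (λ′-tr≡1 u₁) (λ′-tr≡1 v₁)))

  data Polynomial< : ℕ → (F → F) → Set where
    zero-poly : ∀ {f} → (∀ x → f x ≡ 0#) → Polynomial< 0 f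
    horner    : ∀ {n f} c {g} → Polynomial< n g → (∀ x → f x ≡ c + x * g x) → Polynomial< (suc n) f

  Polynomial<-zero : ∀ n {f} → (∀ x → f x ≡ 0#) → Polynomial< n f
  Polynomial<-zero zero    f≡0 = zero-poly f≡0
  Polynomial<-zero (suc n) f≡0 = horner 0# (Polynomial<-zero n (λ _ → refl))
    (λ x → trans (f≡0 x) (sym (trans (+-identityˡ _) (zeroʳ x))))

  Polynomial<-mono : ∀ {m n f} → m ≤ n → Polynomial< m f → Polynomial< n f
  Polynomial<-mono {n = n} z≤n (zero-poly f≡0) = Polynomial<-zero n f≡0
  Polynomial<-mono (s≤s m≤n) (horner c p f≡) = horner c (Polynomial<-mono m≤n p) f≡

  Polynomial<-+ : ∀ {n f f′} → Polynomial< n f → Polynomial< n f′ → Polynomial< n (λ x → f x + f′ x)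
  Polynomial<-+ (zero-poly f≡0) (zero-poly f′≡0) =
    zero-poly (λ x → trans (cong₂ _+_ (f≡0 x) (f′≡0 x)) (+-identityˡ 0#))
  Polynomial<-+ (horner c {g} p f≡) (horner c′ {g′} p′ f′≡) = horner (c + c′) (Polynomial<-+ p p′)
    (λ x → trans (cong₂ _+_ (f≡ x) (f′≡ x))
      (solve 5 (λ c c′ x y y′ → (c :+ x :* y) :+ (c′ :+ x :* y′) := (c :+ c′) :+ x :* (y :+ y′))
             refl c c′ x (g x) (g′ x)))

  Polynomial<-pow : ∀ k → Polynomial< (suc k) (λ x → pow 𝔽 x k)
  Polynomial<-pow zero    = horner 1# (zero-poly (λ _ → refl)) (λ x → sym (trans (cong (1# +_) (zeroʳ x)) (+-identityʳ 1#)))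
  Polynomial<-pow (suc k) = horner 0# (Polynomial<-pow k) (λ x → sym (+-identityˡ _))

  -- In characteristic 2, division by X + α is division by X - α.
  Polynomial<-divide : ∀ {n f} → Polynomial< (suc n) f → ∀ α →
                       Σ (F → F) λ k → Polynomial< n k × (∀ x → f x ≡ (x + α) * k x + f α)
  Polynomial<-divide {zero} {f} (horner c (zero-poly g≡0) f≡) α = (λ _ → 0#) , zero-poly (λ _ → refl) , λ x → begin
    f x                 ≡⟨ constant x ⟩
    c                   ≡⟨ constant α ⟨
    f α                 ≡⟨ +-identityˡ _ ⟨
    0# + f α            ≡⟨ cong (_+ f α) (zeroʳ _) ⟨
    (x + α) * 0# + f α  ∎
    where
    open ≡-Reasoning
    constant : ∀ x → f x ≡ c
    constant x = trans (f≡ x) (trans (cong (λ y → c + x * y) (g≡0 x)) (trans (cong (c +_) (zeroʳ x)) (+-identityʳ c)))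
  Polynomial<-divide {suc n} {f} (horner c {g} p f≡) α with Polynomial<-divide p α
  ... | k , pk , g≡ = (λ x → g α + x * k x) , horner (g α) pk (λ _ → refl) , λ x → begin
    f x                                                 ≡⟨ f≡ x ⟩
    c + x * g x                                         ≡⟨ cong (λ y → c + x * y) (g≡ x) ⟩
    c + x * ((x + α) * k x + g α)                       ≡⟨ drop-two _ _ ⟨
    c + x * ((x + α) * k x + g α) + two * (α * g α)     ≡⟨ solve 5 (λ x α c gα kx →
                                                             c :+ x :* ((x :+ α) :* kx :+ gα) :+ (con 1 :+ con 1) :* (α :* gα)
                                                          := (x :+ α) :* (gα :+ x :* kx) :+ (c :+ α :* gα))
                                                           refl x α c (g α) (k x) ⟩
    (x + α) * (g α + x * k x) + (c + α * g α)           ≡⟨ cong ((x + α) * (g α + x * k x) +_) (f≡ α) ⟨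
    (x + α) * (g α + x * k x) + f α                     ∎
    where open ≡-Reasoning

  pow-divide : ∀ d α → Σ (F → F) λ m → Polynomial< d m ×
               (∀ x → pow 𝔽 x (suc d) ≡ (x + α) * (pow 𝔽 x d + m x) + pow 𝔽 α (suc d))
  pow-divide zero α = (λ _ → 0#) , zero-poly (λ _ → refl) , λ x → sym (trans
    (solve 2 (λ x α → (x :+ α) :* (con 1 :+ con 0) :+ α :* con 1 := x :* con 1 :+ (con 1 :+ con 1) :* α) refl x α)
    (drop-two _ α))
  pow-divide (suc d) α with pow-divide d α
  ... | m , pm , xᵈ⁺¹≡ = (λ x → pow 𝔽 α (suc d) + x * m x) , horner (pow 𝔽 α (suc d)) pm (λ _ → refl) , λ x →
    trans (cong (x *_) (xᵈ⁺¹≡ x)) (sym (trans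
      (solve 5 (λ x α xᵈ mx αᵈ⁺¹ → (x :+ α) :* (x :* xᵈ :+ (αᵈ⁺¹ :+ x :* mx)) :+ α :* αᵈ⁺¹
                                 := x :* ((x :+ α) :* (xᵈ :+ mx) :+ αᵈ⁺¹) :+ (con 1 :+ con 1) :* (α :* αᵈ⁺¹))
             refl x α (pow 𝔽 x d) (m x) (pow 𝔽 α (suc d)))
      (drop-two _ _)))

  Monic : ℕ → (F → F) → Set
  Monic d f = Σ (F → F) λ g → Polynomial< d g × (∀ x → f x ≡ pow 𝔽 x d + g x)

  monic-factor : ∀ {d f} → Monic (suc d) f → ∀ {α} → f α ≡ 0# →
                 Σ (F → F) λ h → Monic d h × (∀ x → f x ≡ (x + α) * h x)
  monic-factor {d} {f} (g , pg , f≡) {α} fα≡0 with Polynomial<-divide pg α | pow-divide d α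
  ... | k , pk , g≡ | m , pm , xᵈ⁺¹≡ =
    (λ x → pow 𝔽 x d + (m x + k x)) , ((λ x → m x + k x) , Polynomial<-+ pm pk , λ _ → refl) , λ x → begin
      f x                                                                 ≡⟨ f≡ x ⟩
      pow 𝔽 x (suc d) + g x                                               ≡⟨ cong₂ _+_ (xᵈ⁺¹≡ x) (g≡ x) ⟩
      (x + α) * (pow 𝔽 x d + m x) + pow 𝔽 α (suc d) + ((x + α) * k x + g α)
        ≡⟨ solve 6 (λ y xᵈ mx αᵈ⁺¹ kx gα → (y :* (xᵈ :+ mx) :+ αᵈ⁺¹) :+ (y :* kx :+ gα)
                                          := y :* (xᵈ :+ (mx :+ kx)) :+ (αᵈ⁺¹ :+ gα))
                 refl (x + α) (pow 𝔽 x d) (m x) (pow 𝔽 α (suc d)) (k x) (g α) ⟩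
      (x + α) * (pow 𝔽 x d + (m x + k x)) + (pow 𝔽 α (suc d) + g α)
        ≡⟨ cong ((x + α) * (pow 𝔽 x d + (m x + k x)) +_) (trans (sym (f≡ α)) fα≡0) ⟩
      (x + α) * (pow 𝔽 x d + (m x + k x)) + 0#                            ≡⟨ +-identityʳ _ ⟩
      (x + α) * (pow 𝔽 x d + (m x + k x))                                 ∎
    where open ≡-Reasoning

  monic-roots : ∀ {d f xs} → Monic d f → Unique xs → All (λ x → f x ≡ 0#) xs → length xs ≤ d
  monic-roots _ _ [] = z≤n
  monic-roots {zero} {f} {x ∷ _} (g , zero-poly g≡0 , f≡) _ (fx≡0 ∷ _) =
    ⊥-elim (0≢1 (sym (trans (sym (trans (cong (1# +_) (g≡0 x)) (+-identityʳ 1#))) (trans (sym (f≡ x)) fx≡0))))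
  monic-roots {suc d} {f} {x ∷ xs} monic (x∉xs ∷ unique) (fx≡0 ∷ roots) with monic-factor monic fx≡0
  ... | h , monic-h , f≡ = s≤s (monic-roots monic-h unique (All.zipWith root-of-h (x∉xs , roots)))
    where
    root-of-h : ∀ {y} → x ≢ y × f y ≡ 0# → h y ≡ 0#
    root-of-h {y} (x≢y , fy≡0) with zero-product (y + x) (h y) (trans (sym (f≡ y)) fy≡0)
    ... | inj₁ y+x≡0 = ⊥-elim (x≢y (sym (x+y≡0⇒x≡y y+x≡0)))
    ... | inj₂ hy≡0  = hy≡0

  traceUpTo-polynomial : ∀ k → Polynomial< (2 ℕ.^ k) (λ x → traceUpTo 𝔽 x k)
  traceUpTo-polynomial zero    = Polynomial<-zero 1 (λ _ → refl)
  traceUpTo-polynomial (suc k) = Polynomial<-+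
    (Polynomial<-mono (ℕP.<⇒≤ 2ᵏ<2ᵏ⁺¹) (traceUpTo-polynomial k))
    (Polynomial<-mono 2ᵏ<2ᵏ⁺¹ (Polynomial<-pow (2 ℕ.^ k)))
    where
    2ᵏ<2ᵏ⁺¹ : 2 ℕ.^ k ℕ.< 2 ℕ.^ suc k
    2ᵏ<2ᵏ⁺¹ = ℕP.^-monoʳ-< 2 (s≤s (s≤s z≤n)) (ℕP.n<1+n k)

  tr-monic : Monic (2 ℕ.^ r) (tr 𝔽)
  tr-monic = (λ x → traceUpTo 𝔽 x r) , traceUpTo-polynomial r , λ x → trans (tr-unfold 𝔽 x) (+-comm _ _)

  -- A monic polynomial of degree q/2 cannot vanish on all of F.
  tr-surjective : Σ F λ v → tr 𝔽 v ≡ 1#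
  tr-surjective with All.all? (λ x → tr 𝔽 x ≟ 0#) elems
  ... | yes all-roots = ⊥-elim (ℕP.<⇒≱ (ℕP.^-monoʳ-< 2 (s≤s (s≤s z≤n)) (ℕP.n<1+n r))
                          (subst (ℕ._≤ 2 ℕ.^ r) card (monic-roots tr-monic elems-unique all-roots)))
  ... | no ¬all with satisfied (¬All⇒Any¬ (λ x → tr 𝔽 x ≟ 0#) elems ¬all)
  ...   | v , tr≢0 = v , [ ⊥-elim ∘ tr≢0 , id ]′ (tr-0-or-1 v)

  ∑-λ′ : ∑[ u ∈ elems ] λ′ 𝔽 u ≡ ℤ.0ℤ
  ∑-λ′ with tr-surjective
  ... | v , tr-v≡1 = i≡-i⇒i≡0 (begin
    ∑[ u ∈ elems ] λ′ 𝔽 u                     ≡⟨ ∑-affine (λ 1≡0 → 0≢1 (sym 1≡0)) v (λ′ 𝔽) ⟨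
    ∑[ u ∈ elems ] λ′ 𝔽 (1# * u + v)
      ≡⟨ ∑-cong elems (λ u → trans (cong (λ w → λ′ 𝔽 (w + v)) (*-identityˡ u)) (λ′-+ u v)) ⟩
    ∑[ u ∈ elems ] (λ′ 𝔽 u ℤ.* λ′ 𝔽 v)
      ≡⟨ ∑-cong elems (λ u → trans (cong (λ′ 𝔽 u ℤ.*_) (λ′-tr≡1 tr-v≡1)) (ℤP.*-comm _ ℤ.-1ℤ)) ⟩
    ∑[ u ∈ elems ] (ℤ.-1ℤ ℤ.* λ′ 𝔽 u)         ≡⟨ ∑-*ˡ elems ℤ.-1ℤ (λ′ 𝔽) ⟩
    ℤ.-1ℤ ℤ.* ∑[ u ∈ elems ] λ′ 𝔽 u           ≡⟨ ℤP.-1*i≡-i _ ⟩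
    ℤ.- ∑[ u ∈ elems ] λ′ 𝔽 u                 ∎)
    where open ≡-Reasoning

  √ : F → F
  √ v = pow 𝔽 v (2 ℕ.^ r)

  √-² : ∀ v → √ v * √ v ≡ v
  √-² v = trans (sym (pow-2^-suc v r)) (pow-q v)

  √-of-² : ∀ z → √ (z * z) ≡ z
  √-of-² z = square-injective (√-² (z * z))

  ∑-z²/a : ∀ {a} → a ≢ 0# → (f : F → ℤ) → ∑[ z ∈ elems ] f (a ⁻¹ * (z * z)) ≡ ∑ elems f
  ∑-z²/a {a} a≢0 = ∑-bijection elems-unique elems-complete (λ z → a ⁻¹ * (z * z)) (λ x → √ (a * x))
    (λ x → trans (cong (a ⁻¹ *_) (√-² (a * x))) (⁻¹-cancelˡ x a≢0))
    (λ z → trans (cong √ (⁻¹-cancelʳ (z * z) a≢0)) (√-of-² z))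

  kloosterman-substitution : ∀ {a z} → a ≢ 0# → z ≢ 0# →
    a * (a ⁻¹ * (z * z)) + a * (a ⁻¹ * (z * z)) ⁻¹ ≡ (z + a * z ⁻¹) * (z + a * z ⁻¹)
  kloosterman-substitution {a} {z} a≢0 z≢0 = begin
    a * (a ⁻¹ * (z * z)) + a * (a ⁻¹ * (z * z)) ⁻¹ ≡⟨ cong₂ _+_ (⁻¹-cancelʳ (z * z) a≢0) (cong (a *_) inverse≡) ⟩
    z * z + a * (a * (z ⁻¹ * z ⁻¹))                ≡⟨ cong (z * z +_) (solve 2 (λ a w → a :* (a :* (w :* w)) := (a :* w) :* (a :* w)) refl a (z ⁻¹)) ⟩
    z * z + a * z ⁻¹ * (a * z ⁻¹)                  ≡⟨ square-+ z (a * z ⁻¹) ⟨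
    (z + a * z ⁻¹) * (z + a * z ⁻¹)                ∎
    where
    open ≡-Reasoning
    inverse≡ : (a ⁻¹ * (z * z)) ⁻¹ ≡ a * (z ⁻¹ * z ⁻¹)
    inverse≡ = ⁻¹-unique (*-nonzero (⁻¹-nonzero a≢0) (*-nonzero z≢0 z≢0)) (begin
      a ⁻¹ * (z * z) * (a * (z ⁻¹ * z ⁻¹))  ≡⟨ solve 4 (λ a⁻¹ z a z⁻¹ → a⁻¹ :* (z :* z) :* (a :* (z⁻¹ :* z⁻¹))
                                                            := (a :* a⁻¹) :* ((z :* z⁻¹) :* (z :* z⁻¹))) refl (a ⁻¹) z a (z ⁻¹) ⟩
      a * a ⁻¹ * (z * z ⁻¹ * (z * z ⁻¹))    ≡⟨ cong₂ (λ u w → u * (w * w)) (inverse a a≢0) (inverse z z≢0) ⟩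
      1# * (1# * 1#)                        ≡⟨ trans (*-identityˡ _) (*-identityˡ _) ⟩
      1#                                    ∎)

  ∑-𝟙-square-root : ∀ v (f : F → ℤ) → ∑[ g ∈ elems ] (𝟙 ((v + g * g) ≟ 0#) ℤ.* f g) ≡ f (√ v)
  ∑-𝟙-square-root v = ∑-𝟙-solution (λ g → (v + g * g) ≟ 0#) (trans (cong (v +_) (√-² v)) (x+x≡0 v))
    (λ g v+g²≡0 → square-injective (trans (sym (x+y≡0⇒x≡y v+g²≡0)) (sym (√-² v))))

module Weight {r : ℕ} (𝔽 : GF (suc r)) {a : GF.F 𝔽} (a≢0 : a ≢ GF.0# 𝔽) where

  open GF 𝔽
  open Field 𝔽
  open CharTwo 𝔽

  ψ : F → ℤ
  ψ u = ℤ.1ℤ ℤ.- λ′ 𝔽 u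

  Q n : ℤ
  Q = ℤ.+ q
  n = ℤ.+ length (nonzero 𝔽)

  ∑-1-nonzero : ∑[ _ ∈ nonzero 𝔽 ] ℤ.1ℤ ≡ n
  ∑-1-nonzero = trans (∑-const (nonzero 𝔽) ℤ.1ℤ) (ℤP.*-identityʳ n)

  unit-pairs : ℤ
  unit-pairs = ∑[ a′ ∈ elems ] ∑[ d ∈ elems ] (𝟙 ((a′ * d) ≟ 1#) ℤ.* ψ (a * (a′ + d + 1#)))

  2·weight≡∑-allMat6 : ℤ.+ 2 ℤ.* ℤ.+ weight 𝔽 a ≡ ∑[ m ∈ allMat6 𝔽 ] (𝟙 (O3? 𝔽 m) ℤ.* ψ (a * MTr 𝔽 m))
  2·weight≡∑-allMat6 = begin
    ℤ.+ 2 ℤ.* ℤ.+ weight 𝔽 a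
      ≡⟨ cong (ℤ.+ 2 ℤ.*_) (trans (length-filter coordinate≢0? (O3 𝔽)) (∑-filter (O3? 𝔽) (allMat6 𝔽) _)) ⟩
    ℤ.+ 2 ℤ.* ∑[ m ∈ allMat6 𝔽 ] (𝟙 (O3? 𝔽 m) ℤ.* 𝟙 (coordinate≢0? m))
      ≡⟨ ∑-*ˡ (allMat6 𝔽) (ℤ.+ 2) _ ⟨
    ∑[ m ∈ allMat6 𝔽 ] (ℤ.+ 2 ℤ.* (𝟙 (O3? 𝔽 m) ℤ.* 𝟙 (coordinate≢0? m)))
      ≡⟨ ∑-cong (allMat6 𝔽) (λ m → trans (*-swap (ℤ.+ 2) (𝟙 (O3? 𝔽 m)) _) (cong (𝟙 (O3? 𝔽 m) ℤ.*_) (2·𝟙[tr≢0]≡ψ _))) ⟩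
    ∑[ m ∈ allMat6 𝔽 ] (𝟙 (O3? 𝔽 m) ℤ.* ψ (a * MTr 𝔽 m))
      ∎
    where
    open ≡-Reasoning
    coordinate≢0? : ∀ m → Dec (tr 𝔽 (a * MTr 𝔽 m) ≢ 0#)
    coordinate≢0? m = ¬? (tr 𝔽 (a * MTr 𝔽 m) ≟ 0#)
    *-swap : ∀ x y z → x ℤ.* (y ℤ.* z) ≡ y ℤ.* (x ℤ.* z)
    *-swap = solve-∀
    2·𝟙[tr≢0]≡ψ : ∀ u → ℤ.+ 2 ℤ.* 𝟙 (¬? (tr 𝔽 u ≟ 0#)) ≡ ψ u
    2·𝟙[tr≢0]≡ψ u with tr 𝔽 u ≟ 0#
    ... | yes _ = refl
    ... | no  _ = refl

  ∑-allMat6 : (G : Mat6 𝔽 → ℤ) → ∑ (allMat6 𝔽) G ≡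
    ∑[ a′ ∈ elems ] ∑[ b ∈ elems ] ∑[ c ∈ elems ] ∑[ d ∈ elems ] ∑[ g ∈ elems ] ∑[ h ∈ elems ] G (a′ , b , c , d , g , h)
  ∑-allMat6 G =
    trans (∑-concatMap _ elems G) (∑-cong elems λ a′ →
    trans (∑-concatMap _ elems G) (∑-cong elems λ b →
    trans (∑-concatMap _ elems G) (∑-cong elems λ c →
    trans (∑-concatMap _ elems G) (∑-cong elems λ d →
    trans (∑-concatMap _ elems G) (∑-cong elems λ g →
    ∑-map _ elems G)))))

  -- The conditions a′c + g² = 0 and bd + h² = 0 determine g and h as square roots.
  ∑-g-h : ∀ a′ b c d →
    ∑[ g ∈ elems ] ∑[ h ∈ elems ] (𝟙 (O3? 𝔽 (a′ , b , c , d , g , h)) ℤ.* ψ (a * (a′ + d + 1#)))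
      ≡ 𝟙 ((a′ * d + b * c) ≟ 1#) ℤ.* ψ (a * (a′ + d + 1#))
  ∑-g-h a′ b c d = begin
    ∑[ g ∈ elems ] ∑[ h ∈ elems ] (𝟙 (O3? 𝔽 (a′ , b , c , d , g , h)) ℤ.* Y)
      ≡⟨ ∑-cong elems (λ g → ∑-cong elems (λ h → factorise g h)) ⟩
    ∑[ g ∈ elems ] ∑[ h ∈ elems ] (𝟙 (g-eq? g) ℤ.* (𝟙 (h-eq? h) ℤ.* X))
      ≡⟨ ∑-cong elems (λ g → ∑-*ˡ elems (𝟙 (g-eq? g)) _) ⟩
    ∑[ g ∈ elems ] (𝟙 (g-eq? g) ℤ.* ∑[ h ∈ elems ] (𝟙 (h-eq? h) ℤ.* X))
      ≡⟨ ∑-cong elems (λ g → cong (𝟙 (g-eq? g) ℤ.*_) (∑-𝟙-square-root (b * d) (λ _ → X))) ⟩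
    ∑[ g ∈ elems ] (𝟙 (g-eq? g) ℤ.* X)
      ≡⟨ ∑-𝟙-square-root (a′ * c) (λ _ → X) ⟩
    X ∎
    where
    open ≡-Reasoning
    Y X : ℤ
    Y = ψ (a * (a′ + d + 1#))
    X = 𝟙 ((a′ * d + b * c) ≟ 1#) ℤ.* Y
    g-eq? : ∀ g → Dec (a′ * c + g * g ≡ 0#)
    h-eq? : ∀ h → Dec (b * d + h * h ≡ 0#)
    g-eq? g = (a′ * c + g * g) ≟ 0#
    h-eq? h = (b * d + h * h) ≟ 0#
    factorise : ∀ g h → 𝟙 (O3? 𝔽 (a′ , b , c , d , g , h)) ℤ.* Y ≡ 𝟙 (g-eq? g) ℤ.* (𝟙 (h-eq? h) ℤ.* X)
    factorise g h = begin
      𝟙 (O3? 𝔽 (a′ , b , c , d , g , h)) ℤ.* Y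
        ≡⟨ cong (ℤ._* Y) (trans (𝟙-× (g-eq? g) _) (cong (𝟙 (g-eq? g) ℤ.*_) (𝟙-× (h-eq? h) _))) ⟩
      𝟙 (g-eq? g) ℤ.* (𝟙 (h-eq? h) ℤ.* 𝟙 ((a′ * d + b * c) ≟ 1#)) ℤ.* Y
        ≡⟨ reassociate (𝟙 (g-eq? g)) (𝟙 (h-eq? h)) _ Y ⟩
      𝟙 (g-eq? g) ℤ.* (𝟙 (h-eq? h) ℤ.* X) ∎
      where
      reassociate : ∀ i j k y → i ℤ.* (j ℤ.* k) ℤ.* y ≡ i ℤ.* (j ℤ.* (k ℤ.* y))
      reassociate = solve-∀

  2·weight≡∑-determinant : ℤ.+ 2 ℤ.* ℤ.+ weight 𝔽 a ≡
    ∑[ a′ ∈ elems ] ∑[ b ∈ elems ] ∑[ c ∈ elems ] ∑[ d ∈ elems ] (𝟙 ((a′ * d + b * c) ≟ 1#) ℤ.* ψ (a * (a′ + d + 1#)))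
  2·weight≡∑-determinant = trans 2·weight≡∑-allMat6 (trans (∑-allMat6 _)
    (∑-cong elems λ a′ → ∑-cong elems λ b → ∑-cong elems λ c → ∑-cong elems λ d → ∑-g-h a′ b c d))

  -- For b ≠ 0 the equation u + bc = 1 has the single solution c = b⁻¹(u + 1).
  ∑-b-c : ∀ u → ∑[ b ∈ elems ] ∑[ c ∈ elems ] 𝟙 ((u + b * c) ≟ 1#) ≡ Q ℤ.* 𝟙 (u ≟ 1#) ℤ.+ n
  ∑-b-c u = begin
    ∑ elems solutions                          ≡⟨ ∑-split-zero solutions ⟩
    solutions 0# ℤ.+ ∑ (nonzero 𝔽) solutions   ≡⟨ cong₂ ℤ._+_ solutions-0 (∑-cong-∈ (nonzero 𝔽) (solutions-≢0 ∘ ∈-nonzero⇒≢0)) ⟩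
    Q ℤ.* 𝟙 (u ≟ 1#) ℤ.+ ∑[ _ ∈ nonzero 𝔽 ] ℤ.1ℤ ≡⟨ cong (ℤ._+_ (Q ℤ.* 𝟙 (u ≟ 1#))) ∑-1-nonzero ⟩
    Q ℤ.* 𝟙 (u ≟ 1#) ℤ.+ n                     ∎
    where
    open ≡-Reasoning
    solutions : F → ℤ
    solutions b = ∑[ c ∈ elems ] 𝟙 ((u + b * c) ≟ 1#)
    solutions-0 : solutions 0# ≡ Q ℤ.* 𝟙 (u ≟ 1#)
    solutions-0 = trans (∑-cong elems (λ c → cong (λ w → 𝟙 (w ≟ 1#)) (trans (cong (u +_) (zeroˡ c)) (+-identityʳ u))))
                        (∑-const-elems _)
    solutions-≢0 : ∀ {b} → b ≢ 0# → solutions b ≡ ℤ.1ℤ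
    solutions-≢0 {b} b≢0 = trans (∑-cong elems (λ c → sym (ℤP.*-identityʳ _)))
      (∑-𝟙-solution (λ c → (u + b * c) ≟ 1#) solves unique (λ _ → ℤ.1ℤ))
      where
      solves : u + b * (b ⁻¹ * (u + 1#)) ≡ 1#
      solves = trans (cong (u +_) (⁻¹-cancelʳ _ b≢0)) (trans (sym (+-assoc u u 1#)) (trans (cong (_+ 1#) (x+x≡0 u)) (+-identityˡ 1#)))
      unique : ∀ c → u + b * c ≡ 1# → c ≡ b ⁻¹ * (u + 1#)
      unique c u+bc≡1 = trans (sym (⁻¹-cancelˡ c b≢0)) (cong (b ⁻¹ *_) (begin
        b * c             ≡⟨ x+c+d≡x (b * c) (x+x≡0 u) ⟨
        b * c + u + u     ≡⟨ cong (_+ u) (+-comm (b * c) u) ⟩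
        u + b * c + u     ≡⟨ cong (_+ u) u+bc≡1 ⟩
        1# + u            ≡⟨ +-comm 1# u ⟩
        u + 1#            ∎))

  -- d ↦ a(a′ + d + 1) is a bijection of F and λ sums to 0 over F.
  ∑-ψ : ∀ a′ → ∑[ d ∈ elems ] ψ (a * (a′ + d + 1#)) ≡ Q
  ∑-ψ a′ = begin
    ∑[ d ∈ elems ] (ℤ.1ℤ ℤ.- λ′ 𝔽 (a * (a′ + d + 1#)))
      ≡⟨ ∑-+ elems (λ _ → ℤ.1ℤ) _ ⟩
    ∑[ _ ∈ elems ] ℤ.1ℤ ℤ.+ ∑[ d ∈ elems ] (ℤ.- λ′ 𝔽 (a * (a′ + d + 1#)))
      ≡⟨ cong₂ ℤ._+_ (trans (∑-const-elems ℤ.1ℤ) (ℤP.*-identityʳ Q)) (∑-cong elems (λ d → sym (ℤP.-1*i≡-i _))) ⟩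
    Q ℤ.+ ∑[ d ∈ elems ] (ℤ.-1ℤ ℤ.* λ′ 𝔽 (a * (a′ + d + 1#)))
      ≡⟨ cong (ℤ._+_ Q) (trans (∑-*ˡ elems ℤ.-1ℤ _) (cong (ℤ.-1ℤ ℤ.*_) ∑λ′≡0)) ⟩
    Q ℤ.+ ℤ.-1ℤ ℤ.* ℤ.0ℤ
      ≡⟨ ℤP.+-identityʳ Q ⟩
    Q ∎
    where
    open ≡-Reasoning
    ∑λ′≡0 : ∑[ d ∈ elems ] λ′ 𝔽 (a * (a′ + d + 1#)) ≡ ℤ.0ℤ
    ∑λ′≡0 = trans (∑-cong elems (λ d → cong (λ′ 𝔽)
              (solve 3 (λ a a′ d → a :* (a′ :+ d :+ con 1) := a :* d :+ a :* (a′ :+ con 1)) refl a a′ d)))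
                  (trans (∑-affine a≢0 (a * (a′ + 1#)) (λ′ 𝔽)) ∑-λ′)

  ∑-b-c-d : ∀ a′ →
    ∑[ b ∈ elems ] ∑[ c ∈ elems ] ∑[ d ∈ elems ] (𝟙 ((a′ * d + b * c) ≟ 1#) ℤ.* ψ (a * (a′ + d + 1#)))
      ≡ n ℤ.* Q ℤ.+ Q ℤ.* ∑[ d ∈ elems ] (𝟙 ((a′ * d) ≟ 1#) ℤ.* ψ (a * (a′ + d + 1#)))
  ∑-b-c-d a′ = begin
    ∑[ b ∈ elems ] ∑[ c ∈ elems ] ∑[ d ∈ elems ] (𝟙 (det? b c d) ℤ.* ψ′ d)
      ≡⟨ trans (∑-cong elems (λ b → ∑-swap elems elems _)) (∑-swap elems elems _) ⟩
    ∑[ d ∈ elems ] ∑[ b ∈ elems ] ∑[ c ∈ elems ] (𝟙 (det? b c d) ℤ.* ψ′ d)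
      ≡⟨ ∑-cong elems (λ d → trans (∑-cong elems (λ b → ∑-*ʳ elems _ (ψ′ d))) (∑-*ʳ elems _ (ψ′ d))) ⟩
    ∑[ d ∈ elems ] ((∑[ b ∈ elems ] ∑[ c ∈ elems ] 𝟙 (det? b c d)) ℤ.* ψ′ d)
      ≡⟨ ∑-cong elems (λ d → trans (cong (ℤ._* ψ′ d) (∑-b-c (a′ * d))) (distribute Q (𝟙 ((a′ * d) ≟ 1#)) n (ψ′ d))) ⟩
    ∑[ d ∈ elems ] (n ℤ.* ψ′ d ℤ.+ Q ℤ.* (𝟙 ((a′ * d) ≟ 1#) ℤ.* ψ′ d))
      ≡⟨ trans (∑-+ elems _ _) (cong₂ ℤ._+_ (∑-*ˡ elems n ψ′) (∑-*ˡ elems Q _)) ⟩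
    n ℤ.* ∑ elems ψ′ ℤ.+ Q ℤ.* ∑[ d ∈ elems ] (𝟙 ((a′ * d) ≟ 1#) ℤ.* ψ′ d)
      ≡⟨ cong (λ s → n ℤ.* s ℤ.+ Q ℤ.* ∑[ d ∈ elems ] (𝟙 ((a′ * d) ≟ 1#) ℤ.* ψ′ d)) (∑-ψ a′) ⟩
    n ℤ.* Q ℤ.+ Q ℤ.* ∑[ d ∈ elems ] (𝟙 ((a′ * d) ≟ 1#) ℤ.* ψ′ d) ∎
    where
    open ≡-Reasoning
    ψ′ : F → ℤ
    ψ′ d = ψ (a * (a′ + d + 1#))
    det? : ∀ b c d → Dec (a′ * d + b * c ≡ 1#)
    det? b c d = (a′ * d + b * c) ≟ 1#
    distribute : ∀ Q i n y → (Q ℤ.* i ℤ.+ n) ℤ.* y ≡ n ℤ.* y ℤ.+ Q ℤ.* (i ℤ.* y)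
    distribute = solve-∀

  ∑-determinant :
    ∑[ a′ ∈ elems ] ∑[ b ∈ elems ] ∑[ c ∈ elems ] ∑[ d ∈ elems ] (𝟙 ((a′ * d + b * c) ≟ 1#) ℤ.* ψ (a * (a′ + d + 1#)))
    ≡ Q ℤ.* (n ℤ.* Q) ℤ.+ Q ℤ.* unit-pairs
  ∑-determinant = trans (∑-cong elems ∑-b-c-d)
    (trans (∑-+ elems _ _) (cong₂ ℤ._+_ (∑-const-elems (n ℤ.* Q)) (∑-*ˡ elems Q _)))

  ∑-unit-pairs : unit-pairs ≡ ∑[ x ∈ nonzero 𝔽 ] ψ (a * (x + x ⁻¹ + 1#))
  ∑-unit-pairs = begin
    ∑ elems partners                            ≡⟨ ∑-split-zero partners ⟩
    partners 0# ℤ.+ ∑ (nonzero 𝔽) partners     ≡⟨ cong₂ ℤ._+_ partners-0 (∑-cong-∈ (nonzero 𝔽) (partners-≢0 ∘ ∈-nonzero⇒≢0)) ⟩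
    ℤ.0ℤ ℤ.+ ∑[ x ∈ nonzero 𝔽 ] ψ (a * (x + x ⁻¹ + 1#)) ≡⟨ ℤP.+-identityˡ _ ⟩
    ∑[ x ∈ nonzero 𝔽 ] ψ (a * (x + x ⁻¹ + 1#)) ∎
    where
    open ≡-Reasoning
    partners : F → ℤ
    partners a′ = ∑[ d ∈ elems ] (𝟙 ((a′ * d) ≟ 1#) ℤ.* ψ (a * (a′ + d + 1#)))
    partners-0 : partners 0# ≡ ℤ.0ℤ
    partners-0 = ∑-𝟙-none (λ d → (0# * d) ≟ 1#) elems _ (All.tabulate (λ {d} _ 0d≡1 → 0≢1 (trans (sym (zeroˡ d)) 0d≡1)))
    partners-≢0 : ∀ {x} → x ≢ 0# → partners x ≡ ψ (a * (x + x ⁻¹ + 1#))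
    partners-≢0 {x} x≢0 = ∑-𝟙-solution (λ d → (x * d) ≟ 1#) (inverse x x≢0)
      (λ d xd≡1 → sym (⁻¹-unique x≢0 xd≡1)) (λ d → ψ (a * (x + d + 1#)))

  ∑-λ′≡K : ∑[ x ∈ nonzero 𝔽 ] λ′ 𝔽 (a * x + a * x ⁻¹) ≡ K 𝔽 a
  ∑-λ′≡K = begin
    ∑[ x ∈ nonzero 𝔽 ] λ′ 𝔽 (a * x + a * x ⁻¹)
      ≡⟨ ∑-filter nonzero? elems _ ⟩
    ∑[ x ∈ elems ] H x
      ≡⟨ ∑-z²/a a≢0 H ⟨
    ∑[ z ∈ elems ] H (σ z)
      ≡⟨ ∑-cong elems H∘σ ⟩
    ∑[ z ∈ elems ] (𝟙 (nonzero? z) ℤ.* λ′ 𝔽 (z + a * z ⁻¹))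
      ≡⟨ ∑-filter nonzero? elems _ ⟨
    ∑[ z ∈ nonzero 𝔽 ] λ′ 𝔽 (z + a * z ⁻¹)
      ≡⟨ K-sum-map 𝔽 a _ (nonzero 𝔽) ⟨
    K-sum 𝔽 a (map (λ z → λ′ 𝔽 (z + a * z ⁻¹)) (nonzero 𝔽))
      ≡⟨ K-unfold 𝔽 a ⟨
    K 𝔽 a ∎
    where
    open ≡-Reasoning
    H : F → ℤ
    H x = 𝟙 (nonzero? x) ℤ.* λ′ 𝔽 (a * x + a * x ⁻¹)
    σ : F → F
    σ z = a ⁻¹ * (z * z)
    H∘σ : ∀ z → H (σ z) ≡ 𝟙 (nonzero? z) ℤ.* λ′ 𝔽 (z + a * z ⁻¹)
    H∘σ z with z ≟ 0# | σ z ≟ 0#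
    ... | yes _   | yes _     = refl
    ... | yes z≡0 | no σz≢0   = ⊥-elim (σz≢0 (trans (cong σ z≡0) (trans (cong (a ⁻¹ *_) (zeroˡ 0#)) (zeroʳ _))))
    ... | no  z≢0 | yes σz≡0  = ⊥-elim (*-nonzero (⁻¹-nonzero a≢0) (*-nonzero z≢0 z≢0) σz≡0)
    ... | no  z≢0 | no  _     = cong (ℤ.1ℤ ℤ.*_) (trans (cong (λ′ 𝔽) (kloosterman-substitution a≢0 z≢0)) (λ′-square _))

  ∑-ψ-nonzero : ∑[ x ∈ nonzero 𝔽 ] ψ (a * (x + x ⁻¹ + 1#)) ≡ n ℤ.- λ′ 𝔽 a ℤ.* K 𝔽 a
  ∑-ψ-nonzero = begin
    ∑[ x ∈ nonzero 𝔽 ] ψ (a * (x + x ⁻¹ + 1#))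
      ≡⟨ ∑-cong (nonzero 𝔽) ψ-split ⟩
    ∑[ x ∈ nonzero 𝔽 ] (ℤ.1ℤ ℤ.+ ℤ.- λ′ 𝔽 a ℤ.* λ′ 𝔽 (a * x + a * x ⁻¹))
      ≡⟨ ∑-+ (nonzero 𝔽) _ _ ⟩
    ∑[ _ ∈ nonzero 𝔽 ] ℤ.1ℤ ℤ.+ ∑[ x ∈ nonzero 𝔽 ] (ℤ.- λ′ 𝔽 a ℤ.* λ′ 𝔽 (a * x + a * x ⁻¹))
      ≡⟨ cong₂ ℤ._+_ ∑-1-nonzero
           (trans (∑-*ˡ (nonzero 𝔽) (ℤ.- λ′ 𝔽 a) (λ x → λ′ 𝔽 (a * x + a * x ⁻¹))) (cong (ℤ.- λ′ 𝔽 a ℤ.*_) ∑-λ′≡K)) ⟩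
    n ℤ.+ ℤ.- λ′ 𝔽 a ℤ.* K 𝔽 a
      ≡⟨ cong (ℤ._+_ n) (ℤP.neg-distribˡ-* (λ′ 𝔽 a) (K 𝔽 a)) ⟨
    n ℤ.- λ′ 𝔽 a ℤ.* K 𝔽 a ∎
    where
    open ≡-Reasoning
    ψ-split : ∀ x → ψ (a * (x + x ⁻¹ + 1#)) ≡ ℤ.1ℤ ℤ.+ ℤ.- λ′ 𝔽 a ℤ.* λ′ 𝔽 (a * x + a * x ⁻¹)
    ψ-split x = begin
      ℤ.1ℤ ℤ.- λ′ 𝔽 (a * (x + x ⁻¹ + 1#))
        ≡⟨ cong (λ u → ℤ.1ℤ ℤ.- λ′ 𝔽 u) (solve 3 (λ a x y → a :* (x :+ y :+ con 1) := (a :* x :+ a :* y) :+ a) refl a x (x ⁻¹)) ⟩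
      ℤ.1ℤ ℤ.- λ′ 𝔽 (a * x + a * x ⁻¹ + a)
        ≡⟨ cong (λ l → ℤ.1ℤ ℤ.- l) (trans (λ′-+ _ a) (ℤP.*-comm _ (λ′ 𝔽 a))) ⟩
      ℤ.1ℤ ℤ.- λ′ 𝔽 a ℤ.* λ′ 𝔽 (a * x + a * x ⁻¹)
        ≡⟨ cong (ℤ._+_ ℤ.1ℤ) (ℤP.neg-distribˡ-* (λ′ 𝔽 a) _) ⟩
      ℤ.1ℤ ℤ.+ ℤ.- λ′ 𝔽 a ℤ.* λ′ 𝔽 (a * x + a * x ⁻¹) ∎

weight-identity : ∀ {Q} n l k → Q ≡ ℤ.1ℤ ℤ.+ n →
  Q ℤ.* (n ℤ.* Q) ℤ.+ Q ℤ.* (n ℤ.- l ℤ.* k) ≡ Q ℤ.* ((Q ℤ.* Q ℤ.- ℤ.1ℤ) ℤ.- l ℤ.* k)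
weight-identity n l k refl = polynomial n l k
  where
  polynomial : ∀ n l k → let Q = ℤ.1ℤ ℤ.+ n in
    Q ℤ.* (n ℤ.* Q) ℤ.+ Q ℤ.* (n ℤ.- l ℤ.* k) ≡ Q ℤ.* ((Q ℤ.* Q ℤ.- ℤ.1ℤ) ℤ.- l ℤ.* k)
  polynomial = solve-∀

open import Data.Integer using (+_)

lemma12 : (r : ℕ) → 1 ≤ r → (𝔽 : GF r) → (a : GF.F 𝔽) → a ≢ GF.0# 𝔽 →
    (+ 2) ℤ.* (+ weight 𝔽 a)
      ≡ (+ (2 ℕ.^ r)) ℤ.* (((+ (2 ℕ.^ r)) ℤ.* (+ (2 ℕ.^ r)) ℤ.- (+ 1)) ℤ.- λ′ 𝔽 a ℤ.* K 𝔽 a)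
lemma12 (suc r) _ 𝔽 a a≢0 = begin
  + 2 ℤ.* + weight 𝔽 a
    ≡⟨ trans 2·weight≡∑-determinant ∑-determinant ⟩
  Q ℤ.* (n ℤ.* Q) ℤ.+ Q ℤ.* unit-pairs
    ≡⟨ cong (λ s → Q ℤ.* (n ℤ.* Q) ℤ.+ Q ℤ.* s) (trans ∑-unit-pairs ∑-ψ-nonzero) ⟩
  Q ℤ.* (n ℤ.* Q) ℤ.+ Q ℤ.* (n ℤ.- λ′ 𝔽 a ℤ.* K 𝔽 a)
    ≡⟨ weight-identity n (λ′ 𝔽 a) (K 𝔽 a) (cong +_ (Field.q≡1+|nonzero| 𝔽)) ⟩
  Q ℤ.* ((Q ℤ.* Q ℤ.- + 1) ℤ.- λ′ 𝔽 a ℤ.* K 𝔽 a) ∎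
  where
  open ≡-Reasoning
  open Weight 𝔽 a≢0
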